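{- The set $\mathrm{RGF}$ of restricted growth functions equals the set of Cayley permutations avoiding the mesh pattern $\mathfrak g$.
   Context: A Cayley permutation of length $n$ is a word $x=x(1)\cdots x(n)$ of positive integers in which every integer from $1$ to $\max(x)$ occurs. A restricted growth function is a Cayley permutation $x$ with $x(1)=1$ and $x(i+1)\le\max\{x(1),\dots,x(i)\}+1$ for $1\le i<n$ (the empty word included). A Cayley permutation $x$ contains the mesh pattern $\mathfrak g$ if there are indices $i<j$ with $x(i)>x(j)$ such that the value $x(j)$ does not occur among $x(1),\dots,x(i-1)$; otherwise $x$ avoids $\mathfrak g$. -}

module Defs where

open import Data.Nat using (ℕ; zero; suc; _≤_; _<_; _⊔_)
open import Data.List using (List; []; _∷_; length; lookup; take; foldr)
open import Data.List.Membership.Propositional using (_∈_)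
open import Data.List.Relation.Unary.All using (All)
open import Data.Fin using (Fin; toℕ)
open import Data.Product using (_×_; ∃-syntax)
open import Data.Unit using (⊤)
open import Relation.Nullary using (¬_)
open import Relation.Binary.PropositionalEquality using (_≡_)

-- A word is a list of natural numbers; position i (0-based Fin index) is x(i+1).
Word : Set
Word = List ℕ

maxW : Word → ℕ
maxW = foldr _⊔_ 0

IsCayley : Word → Set
IsCayley x = All (λ a → 1 ≤ a) x × (∀ k → 1 ≤ k → k ≤ maxW x → k ∈ x)

HeadOne : Word → Set
HeadOne []      = ⊤
HeadOne (a ∷ _) = a ≡ 1

IsRGF : Word → Set
IsRGF x = IsCayley x × HeadOne x ×
  (∀ (i : Fin (length x)) → 1 ≤ toℕ i → lookup x i ≤ suc (maxW (take (toℕ i) x)))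

ContainsG : Word → Set
ContainsG x = ∃[ i ] ∃[ j ] (toℕ i < toℕ j × lookup x j < lookup x i
                             × ¬ (lookup x j ∈ take (toℕ i) x))

AvoidsG : Word → Set
AvoidsG x = ¬ ContainsG x

-- Let m = max x(1..i-1).  If a Cayley permutation jumps at position i, i.e. x(i) > m + 1, then
-- the value m + 1 still occurs in x; it cannot occur before i, so it occurs after i, and together
-- with x(i) that occurrence is an instance of 𝔤.  Conversely, every prefix of a restricted growth
-- function is gap-free; so if i < j and x(j) < x(i), then x(j) ≤ max x(1..i) occurs in x(1..i),
-- and as it differs from x(i) it already occurs in x(1..i-1).
module Submission where

open import Defs
open import Data.Product using (_×_; _,_; proj₁)
open import Function.Bundles using (_⇔_; mk⇔)

open import Data.Nat using (zero; suc; _≤_; _<_; _⊔_; z≤n; s≤s; _≤?_)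
open import Data.Nat.Properties
open import Data.List using ([]; _∷_; length; lookup; take; _∷ʳ_)
open import Data.List.Properties using (take-suc)
open import Data.List.Membership.Propositional using (_∈_; _∉_)
open import Data.List.Membership.Propositional.Properties using (∈-lookup; ∈-++⁻; ∈-++⁺ˡ; ∈-++⁺ʳ)
open import Data.List.Relation.Unary.Any using (here; there; index)
open import Data.List.Relation.Unary.Any.Properties using (lookup-index)
open import Data.List.Relation.Unary.All using (All; _∷_)
import Data.List.Relation.Unary.All as All
open import Data.Fin using (Fin; toℕ; fromℕ<) renaming (zero to fzero; suc to fsuc)
open import Data.Fin.Properties using (toℕ-injective; toℕ-fromℕ<; toℕ<n)
open import Data.Sum using (inj₁; inj₂)
open import Data.Unit using (tt)
open import Relation.Nullary using (¬_; yes; no; contradiction)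
open import Relation.Binary.PropositionalEquality using (_≡_; refl; sym; trans; cong; subst)

GapFree : Word → Set
GapFree ys = ∀ v → 1 ≤ v → v ≤ maxW ys → v ∈ ys

∈⇒≤maxW : ∀ {v ys} → v ∈ ys → v ≤ maxW ys
∈⇒≤maxW {ys = y ∷ ys} (here refl) = m≤m⊔n y (maxW ys)
∈⇒≤maxW {ys = y ∷ ys} (there v∈ys) = ≤-trans (∈⇒≤maxW v∈ys) (m≤n⊔m y (maxW ys))

>maxW⇒∉ : ∀ {v ys} → maxW ys < v → v ∉ ys
>maxW⇒∉ max<v v∈ys = <⇒≱ max<v (∈⇒≤maxW v∈ys)

maxW-∷ʳ : ∀ ys a → maxW (ys ∷ʳ a) ≡ maxW ys ⊔ a
maxW-∷ʳ []       a = ⊔-identityʳ a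
maxW-∷ʳ (y ∷ ys) a = trans (cong (y ⊔_) (maxW-∷ʳ ys a)) (sym (⊔-assoc y (maxW ys) a))

≤⊔∧≰ˡ⇒≤ʳ : ∀ {v m n} → v ≤ m ⊔ n → ¬ v ≤ m → v ≤ n
≤⊔∧≰ˡ⇒≤ʳ {v} {m} {n} v≤m⊔n v≰m with ≤-total m n
... | inj₁ m≤n = subst (v ≤_) (m≤n⇒m⊔n≡n m≤n) v≤m⊔n
... | inj₂ n≤m = contradiction (subst (v ≤_) (m≥n⇒m⊔n≡m n≤m) v≤m⊔n) v≰m

gapFree-∷ʳ : ∀ {ys a} → GapFree ys → a ≤ suc (maxW ys) → GapFree (ys ∷ʳ a)
gapFree-∷ʳ {ys} {a} gapFree a≤1+max v 1≤v v≤max with v ≤? maxW ys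
... | yes v≤maxys = ∈-++⁺ˡ (gapFree v 1≤v v≤maxys)
... | no  v≰maxys = ∈-++⁺ʳ ys (here (≤-antisym v≤a (≤-trans a≤1+max (≰⇒> v≰maxys))))
  where
  v≤a : v ≤ a
  v≤a = ≤⊔∧≰ˡ⇒≤ʳ (subst (v ≤_) (maxW-∷ʳ ys a) v≤max) v≰maxys

lookup∈take : ∀ (x : Word) (j : Fin (length x)) {n} → toℕ j < n → lookup x j ∈ take n x
lookup∈take (a ∷ x) fzero    {suc n} _         = here refl
lookup∈take (a ∷ x) (fsuc j) {suc n} (s≤s j<n) = there (lookup∈take x j j<n)

-- Unlike the clause of IsRGF, this also constrains the first letter: x(1) ≤ 1.
Grows : Word → Set
Grows x = ∀ (i : Fin (length x)) → lookup x i ≤ suc (maxW (take (toℕ i) x))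

grows⇒gapFree-take : ∀ {x} → Grows x → ∀ n → n ≤ length x → GapFree (take n x)
grows⇒gapFree-take g zero    _ v 1≤v v≤0 = contradiction v≤0 (<⇒≱ 1≤v)
grows⇒gapFree-take {x} g (suc n) n<len with fromℕ< n<len | toℕ-fromℕ< n<len
... | i | refl = subst GapFree (sym (take-suc x i))
                   (gapFree-∷ʳ (grows⇒gapFree-take g (toℕ i) (<⇒≤ n<len)) (g i))

grows⇒avoidsG : ∀ {x} → All (1 ≤_) x → Grows x → AvoidsG x
grows⇒avoidsG {x} positive g (i , j , i<j , xj<xi , xj∉prefix) = <-irrefl xj≡xi xj<xi
  where
  xj∈prefix∷ʳxi : lookup x j ∈ take (toℕ i) x ∷ʳ lookup x i
  xj∈prefix∷ʳxi =
    subst (lookup x j ∈_) (take-suc x i)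
      (grows⇒gapFree-take g (suc (toℕ i)) (toℕ<n i) (lookup x j)
        (All.lookup positive (∈-lookup j))
        (≤-trans (<⇒≤ xj<xi) (∈⇒≤maxW (lookup∈take x i ≤-refl))))
  xj≡xi : lookup x j ≡ lookup x i
  xj≡xi with ∈-++⁻ (take (toℕ i) x) xj∈prefix∷ʳxi
  ... | inj₁ xj∈prefix = contradiction xj∈prefix xj∉prefix
  ... | inj₂ (here xj≡xi) = xj≡xi

∈-below∧∉prefix⇒containsG : ∀ {x v} (i : Fin (length x)) →
  v ∈ x → v < lookup x i → v ∉ take (toℕ i) x → ContainsG x
∈-below∧∉prefix⇒containsG {x} {v} i v∈x v<xi v∉prefix =
  i , j , i<j , subst (_< lookup x i) v≡xj v<xi , subst (_∉ take (toℕ i) x) v≡xj v∉prefix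
  where
  j : Fin (length x)
  j = index v∈x
  v≡xj : v ≡ lookup x j
  v≡xj = lookup-index v∈x
  i≤j : toℕ i ≤ toℕ j
  i≤j = ≮⇒≥ (λ j<i → v∉prefix (subst (_∈ take (toℕ i) x) (sym v≡xj) (lookup∈take x j j<i)))
  i<j : toℕ i < toℕ j
  i<j = ≤∧≢⇒< i≤j (λ i≡j → <-irrefl (trans v≡xj (cong (lookup x) (sym (toℕ-injective i≡j)))) v<xi)

cayley×avoidsG⇒grows : ∀ {x} → IsCayley x → AvoidsG x → Grows x
cayley×avoidsG⇒grows {x} (_ , gapFree) avoids i with lookup x i ≤? suc (maxW (take (toℕ i) x))
... | yes grows = grows
... | no  jumps = contradiction
  (∈-below∧∉prefix⇒containsG i 1+max∈x 1+max<xi (>maxW⇒∉ ≤-refl))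
  avoids
  where
  1+max<xi : suc (maxW (take (toℕ i) x)) < lookup x i
  1+max<xi = ≰⇒> jumps
  1+max∈x : suc (maxW (take (toℕ i) x)) ∈ x
  1+max∈x = gapFree _ (s≤s z≤n) (≤-trans (<⇒≤ 1+max<xi) (∈⇒≤maxW {ys = x} (∈-lookup i)))

rgf⇒grows : ∀ x → IsRGF x → Grows x
rgf⇒grows (_ ∷ _) (_ , refl , _)        fzero    = ≤-refl
rgf⇒grows (_ ∷ _) (_ , _ , growsAfter) (fsuc i) = growsAfter (fsuc i) (s≤s z≤n)

grows⇒headOne : ∀ {x} → All (1 ≤_) x → Grows x → HeadOne x
grows⇒headOne {[]}    _         _ = tt
grows⇒headOne {_ ∷ _} (1≤a ∷ _) g = ≤-antisym (g fzero) 1≤a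

cayley×grows⇒rgf : ∀ {x} → IsCayley x → Grows x → IsRGF x
cayley×grows⇒rgf cayley@(positive , _) g = cayley , grows⇒headOne positive g , λ i _ → g i

mainTheorem20 : ∀ (x : Word) → IsRGF x ⇔ (IsCayley x × AvoidsG x)
mainTheorem20 x = mk⇔
  (λ rgf → proj₁ rgf , grows⇒avoidsG (proj₁ (proj₁ rgf)) (rgf⇒grows x rgf))
  (λ (cayley , avoids) → cayley×grows⇒rgf cayley (cayley×avoidsG⇒grows cayley avoids))
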